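{- Let $P_n$ denote the path on $n$ vertices. If $4\leq n\leq 21$, then $\rho(P_n)=3$.
   Context: A $k$-coloring of a graph $G$ is a function $c\colon V(G)\to\{1,\dots,k\}$. A walk in $G$ is a sequence $v_1\cdots v_r$ of vertices with $v_iv_{i+1}\in E(G)$ for all $i$. A sequence $a_1\cdots a_{2t}$ is repetitive if $a_i=a_{i+t}$ for all $i\in\{1,\dots,t\}$. A walk $v_1\cdots v_{2t}$ is a stroll if $v_i\neq v_{i+t}$ for every $i\in\{1,\dots,t\}$. A coloring $c$ is stroll-nonrepetitive if for no stroll $v_1\cdots v_{2t}$ is $c(v_1)\cdots c(v_{2t})$ repetitive. $\rho(G)$ is the minimum $k$ such that $G$ has a stroll-nonrepetitive $k$-coloring. -}

module Defs where

open import Data.Nat using (ℕ; zero; suc; _+_; _≤_; _<_; NonZero)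
open import Data.Fin using (Fin; toℕ)
open import Data.Product using (Σ; _×_; ∃)
open import Relation.Binary.PropositionalEquality using (_≡_; _≢_)
open import Relation.Nullary using (¬_)
open import Data.Sum using (_⊎_; inj₁; inj₂)
open import Data.Nat.Properties using (suc-injective)

record Graph (n : ℕ) : Set₁ where
  field
    Adj   : Fin n → Fin n → Set
    sym   : ∀ {u v} → Adj u v → Adj v u
    irrefl : ∀ {u} → ¬ Adj u u
open Graph public

Coloring : ℕ → ℕ → Set
Coloring n k = Fin n → Fin k

IsWalk : ∀ {n r} → Graph n → (Fin r → Fin n) → Set
IsWalk {r = r} G w = ∀ (i j : Fin r) → toℕ j ≡ suc (toℕ i) → Adj G (w i) (w j)

Repetitive : ∀ {A : Set} (t : ℕ) → (Fin (t + t) → A) → Set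
Repetitive t a = ∀ (i j : Fin (t + t)) → toℕ i < t → toℕ j ≡ toℕ i + t → a i ≡ a j

IsStroll : ∀ {n} → Graph n → (t : ℕ) → (Fin (t + t) → Fin n) → Set
IsStroll G t w =
  (1 ≤ t) × IsWalk G w ×
  (∀ (i j : Fin (t + t)) → toℕ i < t → toℕ j ≡ toℕ i + t → w i ≢ w j)

StrollNonrepetitive : ∀ {n k} → Graph n → Coloring n k → Set
StrollNonrepetitive G c =
  ∀ (t : ℕ) (w : Fin (t + t) → _) → IsStroll G t w → ¬ Repetitive t (λ i → c (w i))

HasSNColoring : ∀ {n} → Graph n → ℕ → Set
HasSNColoring {n} G k = Σ (Coloring n k) (StrollNonrepetitive G)

ρ≡ : ∀ {n} → Graph n → ℕ → Set
ρ≡ G m = HasSNColoring G m × (∀ k → k < m → ¬ HasSNColoring G k)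

n≢1+n : ∀ m → m ≢ suc m
n≢1+n zero ()
n≢1+n (suc m) e = n≢1+n m (suc-injective e)

PathAdj : ∀ {n} → Fin n → Fin n → Set
PathAdj i j = (toℕ j ≡ suc (toℕ i)) ⊎ (toℕ i ≡ suc (toℕ j))

P : (n : ℕ) → Graph n
P n = record { Adj = PathAdj ; sym = sym' ; irrefl = irr }
  where
  sym' : ∀ {u v : Fin n} → PathAdj u v → PathAdj v u
  sym' (inj₁ e) = inj₂ e
  sym' (inj₂ e) = inj₁ e
  irr : ∀ {u : Fin n} → ¬ PathAdj u u
  irr {u} (inj₁ e) = n≢1+n (toℕ u) e
  irr {u} (inj₂ e) = n≢1+n (toℕ u) e

-- Lower bound: with at most two colours, a path v₀v₁v₂v₃ either has a
-- monochromatic edge (a repetitive stroll with t = 1) or is coloured xyxy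
-- (a repetitive stroll with t = 2).
--
-- Upper bound: one explicit 3-colouring of P₂₁ works, and it restricts to
-- every shorter path. To see that it admits no repetitive stroll, fix
-- b = v_{1+t} and follow the pairs (v_i, v_{i+t}) for i = 1, …, t: the
-- first pair is (v₁, b), each pair consists of distinct vertices of equal
-- colour, and consecutive pairs are adjacent coordinatewise. A set of pairs
-- containing all possible first pairs and closed under such steps, none of
-- whose members has its first coordinate adjacent to b, rules out the last
-- pair (v_t, v_{2t}), since v_t is adjacent to v_{1+t} = b. For each b the
-- set of reachable pairs is computed and checked by evaluation.
{-# OPTIONS --safe #-}
module Submission where

open import Defs hiding (sym)
open import Data.Nat using (ℕ; zero; suc; _+_; _*_; _≤_; _<_; _<?_; s≤s; z≤n)
open import Data.Nat.Properties using (suc-injective; +-comm; m≤m+n; +-monoˡ-<; <⇒≤; ≤-refl; <-≤-trans) renaming (_≟_ to _≟ℕ_)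
open import Data.Fin using (Fin; zero; suc; toℕ; fromℕ<; inject≤; _↑ˡ_; _↑ʳ_; #_)
open import Data.Fin.Properties using (_≟_; all?; toℕ<n; toℕ-fromℕ<; toℕ-injective; toℕ-↑ˡ; toℕ-↑ʳ; toℕ-inject≤; inject≤-injective)
open import Data.Vec using (Vec; []; _∷_; _++_; lookup)
open import Data.Vec.Properties using (lookup-++ˡ; lookup-++ʳ)
open import Data.Vec.Relation.Unary.Linked using (Linked; []; [-]; _∷_)
open import Data.Vec.Relation.Binary.Pointwise.Inductive as Pointwise using (Pointwise; []; _∷_)
open import Data.Maybe using (fromMaybe)
open import Data.List using (List; []; _∷_; filter; upTo; cartesianProduct; map; head; drop) renaming (_++_ to _++ₗ_)
open import Data.List.Relation.Unary.All as All using (All)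
open import Data.List.Relation.Unary.Any using (here; there)
open import Data.List.Membership.Propositional using (_∈_)
open import Data.List.Membership.Propositional.Properties using (∈-filter⁺; ∈-map⁺; ∈-upTo⁺; ∈-cartesianProduct⁺; ∈-++⁺ʳ)
import Data.List.Membership.DecPropositional as DecMembership
open import Data.Product using (_×_; _,_; proj₁; proj₂)
open import Data.Product.Properties using (≡-dec)
open import Data.Sum using (_⊎_; inj₁; inj₂)
open import Data.Unit using (tt)
open import Function using (_∘_; id)
open import Relation.Nullary using (¬_; Dec; yes; no; ¬?; _×-dec_; _⊎-dec_; contradiction)
open import Relation.Nullary.Decidable using (toWitness)
open import Relation.Binary.PropositionalEquality using (_≡_; _≢_; refl; sym; trans; cong; subst; subst₂; module ≡-Reasoning)

adj⇒≢ : ∀ {n} (G : Graph n) {u v : Fin n} → Adj G u v → u ≢ v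
adj⇒≢ G uv refl = irrefl G uv

linked⇒isWalk : ∀ {n r} (G : Graph n) {vs : Vec (Fin n) r} → Linked (Adj G) vs → IsWalk G (lookup vs)
linked⇒isWalk _ [-] zero zero ()
linked⇒isWalk _ (_∷_ {xs = _ ∷ _} uv _) zero (suc zero) _ = uv
linked⇒isWalk _ (_ ∷ _) zero zero ()
linked⇒isWalk _ (_ ∷ _) zero (suc (suc _)) ()
linked⇒isWalk _ (_ ∷ _) (suc _) zero ()
linked⇒isWalk G (_ ∷ rest) (suc i) (suc j) j≡1+i = linked⇒isWalk G rest i j (suc-injective j≡1+i)

lookup-++-opposite : ∀ {A : Set} {R : A → A → Set} {t} {xs ys : Vec A t} → Pointwise R xs ys →
  ∀ (i j : Fin (t + t)) → toℕ i < t → toℕ j ≡ toℕ i + t →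
  R (lookup (xs ++ ys) i) (lookup (xs ++ ys) j)
lookup-++-opposite {R = R} {t} {xs} {ys} xs~ys i j i<t j≡i+t =
  subst₂ R (trans (sym (lookup-++ˡ xs ys k)) (cong (lookup (xs ++ ys)) left))
           (trans (sym (lookup-++ʳ xs ys k)) (cong (lookup (xs ++ ys)) right))
           (Pointwise.lookup xs~ys k)
  where
  open ≡-Reasoning
  k : Fin t
  k = fromℕ< i<t
  left : k ↑ˡ t ≡ i
  left = toℕ-injective (trans (toℕ-↑ˡ k t) (toℕ-fromℕ< i<t))
  right : t ↑ʳ k ≡ j
  right = toℕ-injective (begin
    toℕ (t ↑ʳ k)  ≡⟨ toℕ-↑ʳ t k ⟩
    t + toℕ k     ≡⟨ cong (t +_) (toℕ-fromℕ< i<t) ⟩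
    t + toℕ i     ≡⟨ +-comm t (toℕ i) ⟩
    toℕ i + t     ≡⟨ sym j≡i+t ⟩
    toℕ j         ∎)

module _ {n k} (G : Graph n) (c : Coloring n k) where

  repetitiveStroll⇒¬strollNonrepetitive : ∀ {t} (xs ys : Vec (Fin n) (suc t)) →
    Linked (Adj G) (xs ++ ys) → Pointwise _≢_ xs ys → Pointwise (λ u v → c u ≡ c v) xs ys →
    ¬ StrollNonrepetitive G c
  repetitiveStroll⇒¬strollNonrepetitive {t} xs ys walk apart sameColour nonrep =
    nonrep (suc t) (lookup (xs ++ ys))
      (s≤s z≤n , linked⇒isWalk G walk , lookup-++-opposite apart) (lookup-++-opposite sameColour)

  monochromaticEdge⇒¬strollNonrepetitive : ∀ {u v} → Adj G u v → c u ≡ c v → ¬ StrollNonrepetitive G c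
  monochromaticEdge⇒¬strollNonrepetitive {u} {v} uv cu≡cv =
    repetitiveStroll⇒¬strollNonrepetitive (u ∷ []) (v ∷ []) (uv ∷ [-]) (adj⇒≢ G uv ∷ []) (cu≡cv ∷ [])

  alternatingWalk⇒¬strollNonrepetitive : ∀ {v₀ v₁ v₂ v₃} →
    Adj G v₀ v₁ → Adj G v₁ v₂ → Adj G v₂ v₃ → v₀ ≢ v₂ → v₁ ≢ v₃ →
    c v₀ ≡ c v₂ → c v₁ ≡ c v₃ → ¬ StrollNonrepetitive G c
  alternatingWalk⇒¬strollNonrepetitive {v₀} {v₁} {v₂} {v₃} e₀₁ e₁₂ e₂₃ v₀≢v₂ v₁≢v₃ c₀₂ c₁₃ =
    repetitiveStroll⇒¬strollNonrepetitive (v₀ ∷ v₁ ∷ []) (v₂ ∷ v₃ ∷ [])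
      (e₀₁ ∷ e₁₂ ∷ e₂₃ ∷ [-]) (v₀≢v₂ ∷ v₁≢v₃ ∷ []) (c₀₂ ∷ c₁₃ ∷ [])

fin2-≢-≢⇒≡ : {x y z : Fin 2} → x ≢ y → y ≢ z → x ≡ z
fin2-≢-≢⇒≡ {zero}     {zero}     x≢y _   = contradiction refl x≢y
fin2-≢-≢⇒≡ {suc zero} {suc zero} x≢y _   = contradiction refl x≢y
fin2-≢-≢⇒≡ {_}        {zero}     {zero}     _ y≢z = contradiction refl y≢z
fin2-≢-≢⇒≡ {_}        {suc zero} {suc zero} _ y≢z = contradiction refl y≢z
fin2-≢-≢⇒≡ {zero}     {suc zero} {zero}     _ _ = refl
fin2-≢-≢⇒≡ {suc zero} {zero}     {suc zero} _ _ = refl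

fin1-irrelevant : (x y : Fin 1) → x ≡ y
fin1-irrelevant zero zero = refl

walk₄⇒¬hasSNColoring-<3 : ∀ {n k} (G : Graph n) {v₀ v₁ v₂ v₃} →
  Adj G v₀ v₁ → Adj G v₁ v₂ → Adj G v₂ v₃ → v₀ ≢ v₂ → v₁ ≢ v₃ → k < 3 → ¬ HasSNColoring G k
walk₄⇒¬hasSNColoring-<3 {k = 0} G {v₀} _ _ _ _ _ _ (c , _) with c v₀
... | ()
walk₄⇒¬hasSNColoring-<3 {k = 1} G e₀₁ _ _ _ _ _ (c , nonrep) =
  monochromaticEdge⇒¬strollNonrepetitive G c e₀₁ (fin1-irrelevant _ _) nonrep
walk₄⇒¬hasSNColoring-<3 {k = 2} G {v₀} {v₁} {v₂} {v₃} e₀₁ e₁₂ e₂₃ v₀≢v₂ v₁≢v₃ _ (c , nonrep)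
  with c v₀ ≟ c v₁ | c v₁ ≟ c v₂ | c v₂ ≟ c v₃
... | yes c₀₁ | _       | _       = monochromaticEdge⇒¬strollNonrepetitive G c e₀₁ c₀₁ nonrep
... | no _    | yes c₁₂ | _       = monochromaticEdge⇒¬strollNonrepetitive G c e₁₂ c₁₂ nonrep
... | no _    | no _    | yes c₂₃ = monochromaticEdge⇒¬strollNonrepetitive G c e₂₃ c₂₃ nonrep
... | no c₀₁  | no c₁₂  | no c₂₃  =
  alternatingWalk⇒¬strollNonrepetitive G c e₀₁ e₁₂ e₂₃ v₀≢v₂ v₁≢v₃
    (fin2-≢-≢⇒≡ c₀₁ c₁₂) (fin2-≢-≢⇒≡ c₁₂ c₂₃) nonrep
walk₄⇒¬hasSNColoring-<3 {k = suc (suc (suc _))} G _ _ _ _ _ (s≤s (s≤s (s≤s ())))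

-- Inv b over-approximates the pairs (v_i, v_{i+t}) of repetitive strolls with v_{1+t} = b.
record StrollBarrier {n k} (G : Graph n) (c : Coloring n k) : Set₁ where
  field
    Inv   : Fin n → Fin n → Fin n → Set
    start : ∀ {a b} → a ≢ b → c a ≡ c b → Inv b a b
    step  : ∀ {b u v u′ v′} → Inv b u v → Adj G u u′ → Adj G v v′ →
            u′ ≢ v′ → c u′ ≡ c v′ → Inv b u′ v′
    stop  : ∀ {b u v} → Inv b u v → ¬ Adj G u b

barrier⇒strollNonrepetitive : ∀ {n k} {G : Graph n} {c : Coloring n k} →
  StrollBarrier G c → StrollNonrepetitive G c
barrier⇒strollNonrepetitive _ zero _ (() , _)
barrier⇒strollNonrepetitive {n} {G = G} {c} barrier (suc s) w (_ , walk , apart) repetitive =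
  stop (opposite-inv s ≤-refl) (walk-at (toℕ-front s ≤-refl) (toℕ-back 0 (s≤s z≤n)))
  where
  open StrollBarrier barrier
  t = suc s

  front back : ∀ i → i < t → Fin (t + t)
  front i i<t = fromℕ< (<-≤-trans i<t (m≤m+n t t))
  back  i i<t = fromℕ< (+-monoˡ-< t i<t)

  toℕ-front : ∀ i (i<t : i < t) → toℕ (front i i<t) ≡ i
  toℕ-front i i<t = toℕ-fromℕ< (<-≤-trans i<t (m≤m+n t t))

  toℕ-back : ∀ i (i<t : i < t) → toℕ (back i i<t) ≡ i + t
  toℕ-back i i<t = toℕ-fromℕ< (+-monoˡ-< t i<t)

  on-opposite : (R : Fin n → Fin n → Set) →
    (∀ i j → toℕ i < t → toℕ j ≡ toℕ i + t → R (w i) (w j)) →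
    ∀ i (i<t : i < t) → R (w (front i i<t)) (w (back i i<t))
  on-opposite R h i i<t = h _ _
    (subst (_< t) (sym (toℕ-front i i<t)) i<t)
    (trans (toℕ-back i i<t) (cong (_+ t) (sym (toℕ-front i i<t))))

  walk-at : ∀ {x y : Fin (t + t)} {m} → toℕ x ≡ m → toℕ y ≡ suc m → Adj G (w x) (w y)
  walk-at refl y≡1+x = walk _ _ y≡1+x

  b : Fin n
  b = w (back 0 (s≤s z≤n))

  sameColour : Fin n → Fin n → Set
  sameColour u v = c u ≡ c v

  opposite-inv : ∀ i (i<t : i < t) → Inv b (w (front i i<t)) (w (back i i<t))
  opposite-inv zero i<t = start (on-opposite _≢_ apart 0 i<t) (on-opposite sameColour repetitive 0 i<t)
  opposite-inv (suc i) i+1<t = step (opposite-inv i i<t)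
    (walk-at (toℕ-front i i<t) (toℕ-front (suc i) i+1<t))
    (walk-at (toℕ-back i i<t) (toℕ-back (suc i) i+1<t))
    (on-opposite _≢_ apart (suc i) i+1<t) (on-opposite sameColour repetitive (suc i) i+1<t)
    where i<t = <⇒≤ i+1<t

strollNonrepetitive-embed : ∀ {m n k} {H : Graph m} {G : Graph n} {c : Coloring n k}
  (f : Fin m → Fin n) → (∀ {x y} → f x ≡ f y → x ≡ y) → (∀ {u v} → Adj H u v → Adj G (f u) (f v)) →
  StrollNonrepetitive G c → StrollNonrepetitive H (c ∘ f)
strollNonrepetitive-embed f injective adj nonrep t w (1≤t , walk , apart) =
  nonrep t (f ∘ w)
    (1≤t , (λ i j j≡1+i → adj (walk i j j≡1+i)) , (λ i j i<t j≡i+t → apart i j i<t j≡i+t ∘ injective))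

inject≤-pathAdj : ∀ {m n} .(m≤n : m ≤ n) {i j : Fin m} →
  PathAdj i j → PathAdj (inject≤ i m≤n) (inject≤ j m≤n)
inject≤-pathAdj m≤n {i} {j} rewrite toℕ-inject≤ i m≤n | toℕ-inject≤ j m≤n = id

module PathCertificate (n : ℕ) {k} (colour : ℕ → Fin k) where

  open DecMembership (≡-dec _≟ℕ_ _≟ℕ_) using (_∈?_; _∉?_)

  Adjacent : ℕ → ℕ → Set
  Adjacent u v = v ≡ suc u ⊎ u ≡ suc v

  adjacent? : ∀ u v → Dec (Adjacent u v)
  adjacent? u v = (v ≟ℕ suc u) ⊎-dec (u ≟ℕ suc v)

  neighbours : ℕ → List ℕ
  neighbours zero    = 1 ∷ []
  neighbours (suc u) = suc (suc u) ∷ u ∷ []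

  ∈-neighbours : ∀ {u v} → Adjacent u v → v ∈ neighbours u
  ∈-neighbours {zero}  (inj₁ refl) = here refl
  ∈-neighbours {suc _} (inj₁ refl) = here refl
  ∈-neighbours         (inj₂ refl) = there (here refl)

  Pair : Set
  Pair = ℕ × ℕ

  Twin : Pair → Set
  Twin (u , v) = (u < n × v < n) × u ≢ v × colour u ≡ colour v

  twin? : ∀ p → Dec (Twin p)
  twin? (u , v) = ((u <? n) ×-dec (v <? n)) ×-dec ¬? (u ≟ℕ v) ×-dec (colour u ≟ colour v)

  successors : Pair → List Pair
  successors (u , v) = filter twin? (cartesianProduct (neighbours u) (neighbours v))

  initial : ℕ → List Pair
  initial b = filter twin? (map (_, b) (upTo n))

  explore : ℕ → List Pair → List Pair → List Pair
  explore zero    seen _           = seen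
  explore (suc f) seen []          = seen
  explore (suc f) seen (p ∷ queue) = explore f (new ++ₗ seen) (new ++ₗ queue)
    where new = filter (_∉? seen) (successors p)

  ⊆-explore : ∀ f {seen queue p} → p ∈ seen → p ∈ explore f seen queue
  ⊆-explore zero                    p∈ = p∈
  ⊆-explore (suc f) {queue = []}    p∈ = p∈
  ⊆-explore (suc f) {queue = _ ∷ _} p∈ = ⊆-explore f (∈-++⁺ʳ _ p∈)

  -- Each pair is enqueued at most once, so n * n rounds exhaust the search;
  -- soundness does not depend on this, as closure is checked below.
  reachable : ℕ → List Pair
  reachable b = explore (n * n) (initial b) (initial b)

  Closed : List Pair → Set
  Closed S = All (λ p → All (_∈ S) (successors p)) S

  Avoids : ℕ → List Pair → Set
  Avoids b = All (λ p → ¬ Adjacent (proj₁ p) b)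

  -- Passing the list as an argument lets evaluation share it between the checks.
  certifies? : ∀ b S → Dec (Closed S × Avoids b S)
  certifies? b S = All.all? (λ p → All.all? (_∈? S) (successors p)) S
             ×-dec All.all? (λ p → ¬? (adjacent? (proj₁ p) b)) S

  Certified : ℕ → Set
  Certified b = Closed (reachable b) × Avoids b (reachable b)

  certified? : ∀ b → Dec (Certified b)
  certified? b = certifies? b (reachable b)

  certified⇒barrier : (∀ (b : Fin n) → Certified (toℕ b)) → StrollBarrier (P n) (colour ∘ toℕ)
  certified⇒barrier certified = record
    { Inv   = λ b u v → (toℕ u , toℕ v) ∈ reachable (toℕ b)
    ; start = λ {a} {b} a≢b ca≡cb → ⊆-explore (n * n)
                (∈-filter⁺ twin? (∈-map⁺ _ (∈-upTo⁺ (toℕ<n a))) (twin a≢b ca≡cb))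
    ; step  = λ {b} uv∈ uu′ vv′ u′≢v′ cu′≡cv′ → All.lookup (All.lookup (proj₁ (certified b)) uv∈)
                (∈-filter⁺ twin? (∈-cartesianProduct⁺ (∈-neighbours uu′) (∈-neighbours vv′))
                  (twin u′≢v′ cu′≡cv′))
    ; stop  = λ {b} uv∈ → All.lookup (proj₂ (certified b)) uv∈
    }
    where
    twin : ∀ {u v : Fin n} → u ≢ v → colour (toℕ u) ≡ colour (toℕ v) → Twin (toℕ u , toℕ v)
    twin {u} {v} u≢v cu≡cv = (toℕ<n u , toℕ<n v) , u≢v ∘ toℕ-injective , cu≡cv

-- Outside 0, …, 20 the value is junk.
colour₂₁ : ℕ → Fin 3
colour₂₁ i = fromMaybe (# 0) (head (drop i
  (# 0 ∷ # 1 ∷ # 0 ∷ # 2 ∷ # 0 ∷ # 1 ∷ # 2 ∷ # 1 ∷ # 0 ∷ # 2 ∷ # 1 ∷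
   # 2 ∷ # 0 ∷ # 1 ∷ # 2 ∷ # 1 ∷ # 0 ∷ # 2 ∷ # 0 ∷ # 1 ∷ # 0 ∷ [])))

colour₂₁-strollNonrepetitive : StrollNonrepetitive (P 21) (colour₂₁ ∘ toℕ)
colour₂₁-strollNonrepetitive =
  barrier⇒strollNonrepetitive (certified⇒barrier (toWitness {a? = all? (certified? ∘ toℕ)} tt))
  where open PathCertificate 21 colour₂₁

path-hasSNColoring-3 : ∀ {n} → n ≤ 21 → HasSNColoring (P n) 3
path-hasSNColoring-3 {n} n≤21 =
  colour₂₁ ∘ toℕ ∘ embed ,
  strollNonrepetitive-embed {H = P n} {G = P 21} {c = colour₂₁ ∘ toℕ} embed
    (inject≤-injective n≤21 n≤21 _ _) (inject≤-pathAdj n≤21) colour₂₁-strollNonrepetitive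
  where
  embed : Fin n → Fin 21
  embed x = inject≤ x n≤21

path-¬hasSNColoring-<3 : ∀ {n k} → 4 ≤ n → k < 3 → ¬ HasSNColoring (P n) k
path-¬hasSNColoring-<3 (s≤s (s≤s (s≤s (s≤s _)))) =
  walk₄⇒¬hasSNColoring-<3 (P _) {zero} {suc zero} {suc (suc zero)} {suc (suc (suc zero))}
    (inj₁ refl) (inj₁ refl) (inj₁ refl) (λ ()) (λ ())

proposition8 : (n : ℕ) → 4 ≤ n → n ≤ 21 → ρ≡ (P n) 3
proposition8 n 4≤n n≤21 = path-hasSNColoring-3 n≤21 , λ _ → path-¬hasSNColoring-<3 4≤n
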